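{- For every integer $n\ge 0$, \[ \binom{2n}{n}\sum_{k=0}^{n}\frac{(3k)!}{k!^3}\,\frac{(3n-3k)!}{(n-k)!^3}=27^n\binom{2n}{n}\sum_{k=0}^{n}(-1)^{n+k}\binom{n}{k}\binom{2k}{n}\binom{ -1/3}{k}\binom{ -2/3}{k}. \]
   Context: For integers $m\ge0$, $\binom{m}{j}$ is the usual binomial coefficient with $\binom{m}{j}=0$ if $j<0$ or $j>m$; for real $a$ and integer $k\ge0$, $\binom{a}{k}=a(a-1)\cdots(a-k+1)/k!$. -}

module Defs where

open import Data.Nat as ℕ using (ℕ; zero; suc; _!; _^_)
open import Data.Nat.Properties using (_!≢0; m^n≢0)
open import Data.Nat.Combinatorics using (_C_)
open import Data.Integer as ℤ using (+_)
open import Data.Rational using (ℚ; 0ℚ; 1ℚ; _+_; _*_; _-_; -_; _/_)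

⟦_⟧ : ℕ → ℚ
⟦ m ⟧ = + m / 1

Σ≤ : ℕ → (ℕ → ℚ) → ℚ
Σ≤ zero f = f 0
Σ≤ (suc n) f = Σ≤ n f + f (suc n)

sign : ℕ → ℚ
sign zero = 1ℚ
sign (suc m) = - sign m

gbinom : ℚ → ℕ → ℚ
gbinom a zero = 1ℚ
gbinom a (suc k) = gbinom a k * (a - ⟦ k ⟧) * (+ 1 / suc k)

trinom : ℕ → ℚ
trinom k = (+ ((3 ℕ.* k) !) / ((k !) ^ 3)) {{m^n≢0 (k !) 3 {{k !≢0}}}}

-- ordinary binomial coefficient of naturals (0 when j > m), embedded in ℚ
binomℚ : ℕ → ℕ → ℚ
binomℚ m j = ⟦ m C j ⟧

module Submission where

-- Put a k = (3k)!/k!³ = C(3k,k) C(2k,k). Since 27^k C(-1/3,k) C(-2/3,k) = a k and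
-- C(n,k) C(2k,n) = C(2k,k) C(k,n-k), the identity
-- says that two integer convolutions agree:
--   Σ_{k+i=n} a k · a i  =  Σ_{k+i=n} (-27)^i C(k,i) C(2k,k) a k.
-- Both are annihilated by the operator
--   (n+2)³ u(n+2) − 3(2n+3)(9n²+27n+22) u(n+1) + 81(n+1)(3n+2)(3n+4) u(n)
-- and both start 1, 12. For the left-hand side this follows from (k+1)² a(k+1) = 3(3k+1)(3k+2) a k
-- by shifting the index in one factor at a time; for the right-hand side by creative telescoping in k.

open import Defs
open import Data.Nat using (ℕ; zero; suc; z≤n; s≤s; _≤_; _∸_; _^_; _!)
import Data.Nat as ℕ
import Data.Nat.Properties as ℕP
open import Data.Nat.Combinatorics using (_C_)
open import Data.Integer as ℤ using (ℤ; +_; -[1+_]; 0ℤ; NonZero)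
import Data.Integer.Properties as ℤP
open import Data.Rational using (ℚ; 1ℚ)
import Data.Rational.Properties as ℚP
open import Relation.Binary.PropositionalEquality
open ≡-Reasoning

-- Binomial coefficients

module _ where

  open import Data.Nat using (_+_; _*_; _/_; _≤?_)
  open import Data.Nat.Properties
  open import Data.Nat.Combinatorics
  open import Data.Nat.DivMod using (m/n*n≡m)
  open import Data.Nat.Tactic.RingSolver using (solve-∀)
  open import Relation.Nullary using (yes; no)

  pascal : ∀ n k → suc n C suc k ≡ n C k + n C suc k
  pascal n k = sym (nCk+nC[k+1]≡[n+1]C[k+1] n k)

  nCk*k!*[n∸k]!≡n! : ∀ {n k} → k ≤ n → (n C k) * (k ! * (n ∸ k) !) ≡ n !
  nCk*k!*[n∸k]!≡n! {n} {k} k≤n = begin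
    (n C k) * (k ! * (n ∸ k) !)
      ≡⟨ cong (_* (k ! * (n ∸ k) !)) (nCk≡n!/k![n-k]! k≤n) ⟩
    (n ! / (k ! * (n ∸ k) !)) {{k !* (n ∸ k) !≢0}} * (k ! * (n ∸ k) !)
      ≡⟨ m/n*n≡m {{k !* (n ∸ k) !≢0}} (k![n∸k]!∣n! k≤n) ⟩
    n ! ∎

  !-cancelˡ-≡ : ∀ m {x y} → m ! * x ≡ m ! * y → x ≡ y
  !-cancelˡ-≡ m {x} {y} = *-cancelˡ-≡ x y (m !) {{m !≢0}}

  absorption : ∀ k i → suc i * (suc k C suc i) ≡ suc k * (k C i)
  absorption zero    zero    = refl
  absorption zero    (suc i) = *-zeroʳ (suc (suc i))
  absorption (suc k) zero    = trans (*-identityˡ _) (trans (nC1≡n (suc (suc k))) (sym (*-identityʳ (suc (suc k)))))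
  absorption (suc k) (suc i) = begin
    suc (suc i) * (suc (suc k) C suc (suc i))
      ≡⟨ cong (suc (suc i) *_) (pascal (suc k) (suc i)) ⟩
    suc (suc i) * (X + Y)
      ≡⟨ distribute i X Y ⟩
    X + (suc i * X + suc (suc i) * Y)
      ≡⟨ cong (λ u → X + u) (cong₂ _+_ (absorption k i) (absorption k (suc i))) ⟩
    X + (suc k * (k C i) + suc k * (k C suc i))
      ≡⟨ cong (λ u → X + u) (*-distribˡ-+ (suc k) (k C i) (k C suc i)) ⟨
    X + suc k * (k C i + k C suc i)
      ≡⟨ cong (λ u → X + suc k * u) (pascal k i) ⟨
    suc (suc k) * X ∎
    where
    X = suc k C suc i
    Y = suc k C suc (suc i)
    distribute : ∀ i X Y → suc (suc i) * (X + Y) ≡ X + (suc i * X + suc (suc i) * Y)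
    distribute = solve-∀

  lowering : ∀ k i → suc i * (k C suc i) + i * (k C i) ≡ k * (k C i)
  lowering zero    zero    = refl
  lowering zero    (suc i) = cong₂ _+_ (*-zeroʳ (suc (suc i))) (*-zeroʳ (suc i))
  lowering (suc k) zero    = trans (+-identityʳ _) (trans (*-identityˡ _) (trans (nC1≡n (suc k)) (sym (*-identityʳ (suc k)))))
  lowering (suc k) (suc i) = begin
    suc (suc i) * (suc k C suc (suc i)) + suc i * (suc k C suc i)
      ≡⟨ cong₂ (λ u v → suc (suc i) * u + suc i * v) (pascal k (suc i)) (pascal k i) ⟩
    suc (suc i) * (C₁ + C₂) + suc i * (C₀ + C₁)                 ≡⟨ regroup i C₀ C₁ C₂ ⟩
    (suc (suc i) * C₂ + suc i * C₁) + (suc i * C₁ + i * C₀) + C₁ + C₀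
      ≡⟨ cong₂ (λ u v → u + v + C₁ + C₀) (lowering k (suc i)) (lowering k i) ⟩
    k * C₁ + k * C₀ + C₁ + C₀                                   ≡⟨ collect k C₀ C₁ ⟩
    suc k * (C₀ + C₁)                                           ≡⟨ cong (suc k *_) (pascal k i) ⟨
    suc k * (suc k C suc i)                                     ∎
    where
    C₀ = k C i
    C₁ = k C suc i
    C₂ = k C suc (suc i)
    regroup : ∀ i C₀ C₁ C₂ → suc (suc i) * (C₁ + C₂) + suc i * (C₀ + C₁)
                           ≡ (suc (suc i) * C₂ + suc i * C₁) + (suc i * C₁ + i * C₀) + C₁ + C₀
    regroup = solve-∀
    collect : ∀ k C₀ C₁ → k * C₁ + k * C₀ + C₁ + C₀ ≡ suc k * (C₀ + C₁)
    collect = solve-∀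

  central : ℕ → ℕ
  central k = (k + k) C k

  central-rec : ∀ k → suc k * central (suc k) ≡ 2 * (2 * k + 1) * central k
  central-rec k = begin
    suc k * ((suc k + suc k) C suc k)           ≡⟨ cong (λ m → suc k * (m C suc k)) (+-suc (suc k) k) ⟩
    suc k * (suc (suc (k + k)) C suc k)         ≡⟨ absorption (suc (k + k)) k ⟩
    suc (suc (k + k)) * X                       ≡⟨ double k X ⟩
    2 * (suc k * X)                             ≡⟨ cong (λ x → 2 * (suc k * x)) symmetric ⟩
    2 * (suc k * Y)                             ≡⟨ cong (2 *_) (absorption (k + k) k) ⟩
    2 * (suc (k + k) * ((k + k) C k))           ≡⟨ odd k (central k) ⟩
    2 * (2 * k + 1) * central k                 ∎
    where
    X = suc (k + k) C k
    Y = suc (k + k) C suc k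
    double : ∀ k X → suc (suc (k + k)) * X ≡ 2 * (suc k * X)
    double = solve-∀
    odd : ∀ k c → 2 * (suc (k + k) * c) ≡ 2 * (2 * k + 1) * c
    odd = solve-∀
    symmetric : X ≡ Y
    symmetric = sym (trans (nCk≡nC[n∸k] (s≤s (m≤m+n k k))) (cong (suc (k + k) C_) (m+n∸m≡n k k)))

  C-revision : ∀ m n k → k ≤ n → (n C k) * (m C n) ≡ (m C k) * ((m ∸ k) C (n ∸ k))
  C-revision m n k k≤n with n ≤? m
  ... | no n≰m = begin
    (n C k) * (m C n)                   ≡⟨ cong ((n C k) *_) (k>n⇒nCk≡0 (≰⇒> n≰m)) ⟩
    (n C k) * 0                         ≡⟨ *-zeroʳ (n C k) ⟩
    0                                   ≡⟨ vanishes ⟨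
    (m C k) * ((m ∸ k) C (n ∸ k))       ∎
    where
    vanishes : (m C k) * ((m ∸ k) C (n ∸ k)) ≡ 0
    vanishes with k ≤? m
    ... | yes k≤m = trans (cong ((m C k) *_) (k>n⇒nCk≡0 (∸-monoˡ-< (≰⇒> n≰m) k≤m))) (*-zeroʳ (m C k))
    ... | no k≰m  = cong (_* ((m ∸ k) C (n ∸ k))) (k>n⇒nCk≡0 (≰⇒> k≰m))
  ... | yes n≤m = !-cancelˡ-≡ k (!-cancelˡ-≡ (n ∸ k) (!-cancelˡ-≡ (m ∸ n) (begin
    e ! * (d ! * (k ! * ((n C k) * (m C n))))
      ≡⟨ shuffle₁ (k !) (d !) (e !) (n C k) (m C n) ⟩
    (m C n) * ((n C k) * (k ! * d !) * e !)
      ≡⟨ cong (λ u → (m C n) * (u * e !)) (nCk*k!*[n∸k]!≡n! k≤n) ⟩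
    (m C n) * (n ! * e !)
      ≡⟨ nCk*k!*[n∸k]!≡n! n≤m ⟩
    m !
      ≡⟨ nCk*k!*[n∸k]!≡n! k≤m ⟨
    (m C k) * (k ! * (m ∸ k) !)
      ≡⟨ cong (λ u → (m C k) * (k ! * u)) (nCk*k!*[n∸k]!≡n! d≤m-k) ⟨
    (m C k) * (k ! * (((m ∸ k) C d) * (d ! * (m ∸ k ∸ d) !)))
      ≡⟨ cong (λ u → (m C k) * (k ! * (((m ∸ k) C d) * (d ! * u !)))) m-k-d≡e ⟩
    (m C k) * (k ! * (((m ∸ k) C d) * (d ! * e !)))
      ≡⟨ shuffle₂ (k !) (d !) (e !) (m C k) ((m ∸ k) C d) ⟩
    e ! * (d ! * (k ! * ((m C k) * ((m ∸ k) C d)))) ∎)))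
    where
    d = n ∸ k
    e = m ∸ n
    k≤m : k ≤ m
    k≤m = ≤-trans k≤n n≤m
    d≤m-k : d ≤ m ∸ k
    d≤m-k = ∸-monoˡ-≤ k n≤m
    m-k-d≡e : m ∸ k ∸ d ≡ e
    m-k-d≡e = trans (∸-+-assoc m k d) (cong (m ∸_) (m+[n∸m]≡n k≤n))
    shuffle₁ : ∀ K D E a b → E * (D * (K * (a * b))) ≡ b * (a * (K * D) * E)
    shuffle₁ = solve-∀
    shuffle₂ : ∀ K D E c x → c * (K * (x * (D * E))) ≡ E * (D * (K * (c * x)))
    shuffle₂ = solve-∀

  C-revision-central : ∀ n k → k ≤ n → (n C k) * ((2 * k) C n) ≡ (k C (n ∸ k)) * central k
  C-revision-central n k k≤n = begin
    (n C k) * ((2 * k) C n)               ≡⟨ cong (λ m → (n C k) * ((k + m) C n)) (+-identityʳ k) ⟩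
    (n C k) * ((k + k) C n)               ≡⟨ C-revision (k + k) n k k≤n ⟩
    central k * ((k + k ∸ k) C (n ∸ k))   ≡⟨ cong (λ m → central k * (m C (n ∸ k))) (m+n∸m≡n k k) ⟩
    central k * (k C (n ∸ k))             ≡⟨ *-comm (central k) (k C (n ∸ k)) ⟩
    (k C (n ∸ k)) * central k             ∎

  central-factorial : ∀ k → (k + k) ! ≡ central k * (k ! * k !)
  central-factorial k = begin
    (k + k) !                                 ≡⟨ nCk*k!*[n∸k]!≡n! (m≤m+n k k) ⟨
    central k * (k ! * (k + k ∸ k) !)         ≡⟨ cong (λ m → central k * (k ! * m !)) (m+n∸m≡n k k) ⟩
    central k * (k ! * k !)                   ∎

  trinomial : ℕ → ℕ
  trinomial k = ((k + (k + k)) C k) * central k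

  trinomial-factorial : ∀ k → (3 * k) ! ≡ (k !) ^ 3 * trinomial k
  trinomial-factorial k = begin
    (3 * k) !                                 ≡⟨ cong _! (triple k) ⟩
    (k + (k + k)) !                           ≡⟨ nCk*k!*[n∸k]!≡n! (m≤m+n k (k + k)) ⟨
    C₃ * (k ! * (k + (k + k) ∸ k) !)          ≡⟨ cong (λ m → C₃ * (k ! * m !)) (m+n∸m≡n k (k + k)) ⟩
    C₃ * (k ! * (k + k) !)                    ≡⟨ cong (λ m → C₃ * (k ! * m)) (central-factorial k) ⟩
    C₃ * (k ! * (central k * (k ! * k !)))    ≡⟨ collect (k !) C₃ (central k) ⟩
    (k !) ^ 3 * trinomial k                   ∎
    where
    C₃ = (k + (k + k)) C k
    triple : ∀ k → 3 * k ≡ k + (k + k)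
    triple = solve-∀
    collect : ∀ F a b → a * (F * (b * (F * F))) ≡ F * (F * (F * 1)) * (a * b)
    collect = solve-∀

  trinomial-rec : ∀ k → suc k * suc k * trinomial (suc k) ≡ 3 * (3 * k + 1) * (3 * k + 2) * trinomial k
  trinomial-rec k = *-cancelˡ-≡ _ _ (suc k) (*-cancelˡ-≡ _ _ ((k !) ^ 3) {{m^n≢0 (k !) 3 {{k !≢0}}}} (begin
    (k !) ^ 3 * (suc k * (suc k * suc k * trinomial (suc k)))
      ≡⟨ collect (k !) (suc k) (trinomial (suc k)) ⟩
    (suc k !) ^ 3 * trinomial (suc k)
      ≡⟨ trinomial-factorial (suc k) ⟨
    (3 * suc k) !
      ≡⟨ cong _! (triple-suc k) ⟩
    (3 + 3 * k) !
      ≡⟨ cong (λ m → (3 + 3 * k) * ((2 + 3 * k) * ((1 + 3 * k) * m))) (trinomial-factorial k) ⟩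
    (3 + 3 * k) * ((2 + 3 * k) * ((1 + 3 * k) * ((k !) ^ 3 * trinomial k)))
      ≡⟨ expand (k !) k (trinomial k) ⟩
    (k !) ^ 3 * (suc k * (3 * (3 * k + 1) * (3 * k + 2) * trinomial k)) ∎))
    where
    collect : ∀ F s x → F * (F * (F * 1)) * (s * (s * s * x)) ≡ s * F * (s * F * (s * F * 1)) * x
    collect = solve-∀
    triple-suc : ∀ k → 3 * suc k ≡ 3 + 3 * k
    triple-suc = solve-∀
    expand : ∀ F k x → (3 + 3 * k) * ((2 + 3 * k) * ((1 + 3 * k) * (F * (F * (F * 1)) * x)))
                     ≡ F * (F * (F * 1)) * ((1 + k) * (3 * (3 * k + 1) * (3 * k + 2) * x))
    expand = solve-∀

-- Finite sums and convolutions over ℤ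

module _ where

  open import Data.Integer using (_+_; _*_; -_; _-_)
  open import Data.Integer.Tactic.RingSolver using (solve-∀)
  open import Data.Product using (_×_; _,_; proj₁)

  sum≤ : ℕ → (ℕ → ℤ) → ℤ
  sum≤ zero    f = f 0
  sum≤ (suc n) f = sum≤ n f + f (suc n)

  sum≤-cong : ∀ n {f g : ℕ → ℤ} → (∀ k → k ≤ n → f k ≡ g k) → sum≤ n f ≡ sum≤ n g
  sum≤-cong zero    f≗g = f≗g 0 z≤n
  sum≤-cong (suc n) f≗g =
    cong₂ _+_ (sum≤-cong n (λ k k≤n → f≗g k (ℕP.m≤n⇒m≤1+n k≤n))) (f≗g (suc n) ℕP.≤-refl)

  sum≤-+ : ∀ n (f g : ℕ → ℤ) → sum≤ n (λ k → f k + g k) ≡ sum≤ n f + sum≤ n g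
  sum≤-+ zero    f g = refl
  sum≤-+ (suc n) f g = trans (cong (_+ (f (suc n) + g (suc n))) (sum≤-+ n f g))
                             (interchange (sum≤ n f) (sum≤ n g) (f (suc n)) (g (suc n)))
    where
    interchange : ∀ a b c d → a + b + (c + d) ≡ a + c + (b + d)
    interchange = solve-∀

  *-distribˡ-sum≤ : ∀ n c (f : ℕ → ℤ) → c * sum≤ n f ≡ sum≤ n (λ k → c * f k)
  *-distribˡ-sum≤ zero    c f = refl
  *-distribˡ-sum≤ (suc n) c f =
    trans (ℤP.*-distribˡ-+ c (sum≤ n f) (f (suc n))) (cong (_+ c * f (suc n)) (*-distribˡ-sum≤ n c f))

  sum≤-suc : ∀ n (f : ℕ → ℤ) → sum≤ (suc n) f ≡ f 0 + sum≤ n (λ k → f (suc k))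
  sum≤-suc zero    f = refl
  sum≤-suc (suc n) f = trans (cong (_+ f (suc (suc n))) (sum≤-suc n f))
                             (ℤP.+-assoc (f 0) _ _)

  sum≤-zero : ∀ n → sum≤ n (λ _ → 0ℤ) ≡ 0ℤ
  sum≤-zero zero    = refl
  sum≤-zero (suc n) = cong (_+ 0ℤ) (sum≤-zero n)

  sum≤-telescope : ∀ n (h : ℕ → ℤ) → sum≤ n (λ k → h (suc k) - h k) ≡ h (suc n) - h 0
  sum≤-telescope zero    h = refl
  sum≤-telescope (suc n) h = trans (cong (_+ (h (suc (suc n)) - h (suc n))) (sum≤-telescope n h))
                                   (collapse (h (suc (suc n))) (h (suc n)) (h 0))
    where
    collapse : ∀ a b c → b - c + (a - b) ≡ a - c
    collapse = solve-∀

  conv : (ℕ → ℕ → ℤ) → ℕ → ℤ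
  conv f m = sum≤ m (λ k → f k (m ℕ.∸ k))

  conv-cong : ∀ m {f g : ℕ → ℕ → ℤ} → (∀ k j → k ℕ.+ j ≡ m → f k j ≡ g k j) → conv f m ≡ conv g m
  conv-cong m f≗g = sum≤-cong m (λ k k≤m → f≗g k (m ℕ.∸ k) (ℕP.m+[n∸m]≡n k≤m))

  conv-+ : ∀ m (f g : ℕ → ℕ → ℤ) → conv (λ k j → f k j + g k j) m ≡ conv f m + conv g m
  conv-+ m f g = sum≤-+ m _ _

  *-distribˡ-conv : ∀ m c (f : ℕ → ℕ → ℤ) → c * conv f m ≡ conv (λ k j → c * f k j) m
  *-distribˡ-conv m c f = *-distribˡ-sum≤ m c _

  conv-sucˡ : ∀ m (f : ℕ → ℕ → ℤ) → conv f (suc m) ≡ f 0 (suc m) + conv (λ k → f (suc k)) m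
  conv-sucˡ m f = sum≤-suc m _

  conv-sucʳ : ∀ m (f : ℕ → ℕ → ℤ) → conv f (suc m) ≡ conv (λ k j → f k (suc j)) m + f (suc m) 0
  conv-sucʳ m f = cong₂ _+_ (sum≤-cong m (λ k k≤m → cong (f k) (ℕP.+-∸-assoc 1 k≤m)))
                            (cong (f (suc m)) (ℕP.n∸n≡0 m))

  conv-zero : ∀ m → conv (λ _ _ → 0ℤ) m ≡ 0ℤ
  conv-zero = sum≤-zero

  conv-linear : ∀ m c (f g h : ℕ → ℕ → ℤ) → (∀ k j → k ℕ.+ j ≡ m → c * f k j + g k j ≡ h k j) →
                c * conv f m + conv g m ≡ conv h m
  conv-linear m c f g h pointwise = begin
    c * conv f m + conv g m                     ≡⟨ cong (_+ conv g m) (*-distribˡ-conv m c f) ⟩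
    conv (λ k j → c * f k j) m + conv g m       ≡⟨ conv-+ m (λ k j → c * f k j) g ⟨
    conv (λ k j → c * f k j + g k j) m          ≡⟨ conv-cong m pointwise ⟩
    conv h m                                    ∎

  -- Second-order recurrences

  SolvesRecurrence : (c₀ c₁ c₂ : ℕ → ℤ) → (ℕ → ℤ) → Set
  SolvesRecurrence c₀ c₁ c₂ u =
    ∀ n → c₂ n * u (suc (suc n)) + c₁ n * u (suc n) + c₀ n * u n ≡ 0ℤ

  module _ {c₀ c₁ c₂ : ℕ → ℤ} where

    leading-term : ∀ {u} → SolvesRecurrence c₀ c₁ c₂ u →
                   ∀ n → c₂ n * u (suc (suc n)) ≡ - (c₁ n * u (suc n) + c₀ n * u n)
    leading-term {u} rec n = begin
      x                        ≡⟨ isolate x y z ⟩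
      - (y + z) + (x + y + z)  ≡⟨ cong (λ s → - (y + z) + s) (rec n) ⟩
      - (y + z) + 0ℤ           ≡⟨ ℤP.+-identityʳ _ ⟩
      - (y + z)                ∎
      where
      x = c₂ n * u (suc (suc n))
      y = c₁ n * u (suc n)
      z = c₀ n * u n
      isolate : ∀ x y z → x ≡ - (y + z) + (x + y + z)
      isolate = solve-∀

    recurrence-unique : (∀ n → NonZero (c₂ n)) → ∀ {u v} →
                        SolvesRecurrence c₀ c₁ c₂ u → SolvesRecurrence c₀ c₁ c₂ v →
                        u 0 ≡ v 0 → u 1 ≡ v 1 → ∀ n → u n ≡ v n
    recurrence-unique c₂≢0 {u} {v} recu recv u₀≡v₀ u₁≡v₁ n = proj₁ (agree n)
      where
      agree : ∀ n → u n ≡ v n × u (suc n) ≡ v (suc n)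
      agree zero    = u₀≡v₀ , u₁≡v₁
      agree (suc n) with agree n
      ... | uₙ≡vₙ , uₙ₊₁≡vₙ₊₁ = uₙ₊₁≡vₙ₊₁ , ℤP.*-cancelˡ-≡ (c₂ n) _ _ {{c₂≢0 n}} (begin
        c₂ n * u (suc (suc n))               ≡⟨ leading-term recu n ⟩
        - (c₁ n * u (suc n) + c₀ n * u n)    ≡⟨ cong₂ (λ x y → - (c₁ n * x + c₀ n * y)) uₙ₊₁≡vₙ₊₁ uₙ≡vₙ ⟩
        - (c₁ n * v (suc n) + c₀ n * v n)    ≡⟨ leading-term recv n ⟨
        c₂ n * v (suc (suc n))               ∎)

  p₀ p₁ p₂ : ℤ → ℤ
  p₀ N = + 81 * (N + + 1) * (+ 3 * N + + 2) * (+ 3 * N + + 4)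
  p₁ N = - (+ 3 * (+ 2 * N + + 3) * (+ 9 * N * N + + 27 * N + + 22))
  p₂ N = (+ 2 + N) * (+ 2 + N) * (+ 2 + N)

  SolvesP : (ℕ → ℤ) → Set
  SolvesP = SolvesRecurrence (λ n → p₀ (+ n)) (λ n → p₁ (+ n)) (λ n → p₂ (+ n))

  k+j≡d+n⇒n≡k+j-d : ∀ {n} k j d → k ℕ.+ j ≡ d ℕ.+ n → + n ≡ + k + + j - + d
  k+j≡d+n⇒n≡k+j-d {n} k j d k+j≡d+n = trans (cancel (+ d) (+ n)) (cong (_- + d) (cong +_ (sym k+j≡d+n)))
    where
    cancel : ∀ D N → N ≡ D + N - D
    cancel = solve-∀

  -- (k+1)² a(k+1) = c k · a k trades a weight k² (or j²) for an index shift; the k = 0 (or j = 0) term is killed.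
  module ShiftedConvolution (c : ℤ → ℤ) (a : ℕ → ℤ)
                            (a-rec : ∀ k → + suc k * + suc k * a (suc k) ≡ c (+ k) * a k) where

    weighted shifted : (P Q : ℤ → ℤ → ℤ) → ℕ → ℕ → ℤ
    weighted P Q k j = (+ k * + k * P (+ k) (+ j) + + j * + j * Q (+ k) (+ j)) * (a k * a j)
    shifted  P Q k j = (c (+ k) * P (+ suc k) (+ j) + c (+ j) * Q (+ k) (+ suc j)) * (a k * a j)

    conv-shift : ∀ m P Q → conv (weighted P Q) (suc m) ≡ conv (shifted P Q) m
    conv-shift m P Q = begin
      conv (weighted P Q) (suc m)
        ≡⟨ conv-cong (suc m) (λ k j _ → split (+ k * + k) (P (+ k) (+ j)) (+ j * + j) (Q (+ k) (+ j)) (a k) (a j)) ⟩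
      conv (λ k j → fₖ k j + fⱼ k j) (suc m)
        ≡⟨ conv-+ (suc m) fₖ fⱼ ⟩
      conv fₖ (suc m) + conv fⱼ (suc m)
        ≡⟨ cong₂ _+_ left right ⟩
      conv gₖ m + conv gⱼ m
        ≡⟨ conv-+ m gₖ gⱼ ⟨
      conv (λ k j → gₖ k j + gⱼ k j) m
        ≡⟨ conv-cong m (λ k j _ → sym (split (c (+ k)) (P (+ suc k) (+ j)) (c (+ j)) (Q (+ k) (+ suc j)) (a k) (a j))) ⟩
      conv (shifted P Q) m ∎
      where
      split : ∀ u p v q x y → (u * p + v * q) * (x * y) ≡ u * x * (p * y) + v * y * (q * x)
      split = solve-∀
      fₖ fⱼ gₖ gⱼ : ℕ → ℕ → ℤ
      fₖ k j = + k * + k * a k * (P (+ k) (+ j) * a j)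
      fⱼ k j = + j * + j * a j * (Q (+ k) (+ j) * a k)
      gₖ k j = c (+ k) * a k * (P (+ suc k) (+ j) * a j)
      gⱼ k j = c (+ j) * a j * (Q (+ k) (+ suc j) * a k)
      left : conv fₖ (suc m) ≡ conv gₖ m
      left = begin
        conv fₖ (suc m)                       ≡⟨ conv-sucˡ m fₖ ⟩
        0ℤ + conv (λ k → fₖ (suc k)) m        ≡⟨ ℤP.+-identityˡ _ ⟩
        conv (λ k → fₖ (suc k)) m             ≡⟨ conv-cong m (λ k j _ → cong (_* (P (+ suc k) (+ j) * a j)) (a-rec k)) ⟩
        conv gₖ m                             ∎
      right : conv fⱼ (suc m) ≡ conv gⱼ m
      right = begin
        conv fⱼ (suc m)                       ≡⟨ conv-sucʳ m fⱼ ⟩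
        conv (λ k j → fⱼ k (suc j)) m + 0ℤ    ≡⟨ ℤP.+-identityʳ _ ⟩
        conv (λ k j → fⱼ k (suc j)) m         ≡⟨ conv-cong m (λ k j _ → cong (_* (Q (+ k) (+ suc j) * a k)) (a-rec j)) ⟩
        conv gⱼ m                             ∎

  c₃ : ℤ → ℤ
  c₃ K = + 3 * (+ 3 * K + + 1) * (+ 3 * K + + 2)

  module _ (a : ℕ → ℤ) (a-rec : ∀ k → + suc k * + suc k * a (suc k) ≡ c₃ (+ k) * a k) where

    open ShiftedConvolution c₃ a a-rec

    -- Split p₂ at k + j = n + 2 as (k+j)³ = k²(k+3j) + j²(3k+j) and shift; together with p₁ the
    -- weights become k² A′ + j² B′ at level n + 1, and after a second shift they cancel p₀.
    self-convolution-recurrence : SolvesP (conv (λ k j → a k * a j))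
    self-convolution-recurrence n = begin
      p₂ N * X (suc (suc n)) + p₁ N * X (suc n) + p₀ N * X n
        ≡⟨ cong (λ s → s + p₁ N * X (suc n) + p₀ N * X n) step₂ ⟩
      S₂ + p₁ N * X (suc n) + p₀ N * X n
        ≡⟨ cong (_+ p₀ N * X n) (ℤP.+-comm S₂ (p₁ N * X (suc n))) ⟩
      p₁ N * X (suc n) + S₂ + p₀ N * X n
        ≡⟨ cong (_+ p₀ N * X n) step₁ ⟩
      S₁ + p₀ N * X n
        ≡⟨ ℤP.+-comm S₁ (p₀ N * X n) ⟩
      p₀ N * X n + S₁
        ≡⟨ step₀ ⟩
      0ℤ ∎
      where
      N = + n
      aa : ℕ → ℕ → ℤ
      aa k j = a k * a j
      X = conv aa
      A B A′ B′ : ℤ → ℤ → ℤ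
      A  K J = K + + 3 * J
      B  K J = + 3 * K + J
      A′ K J = - (+ 27 + + 27 * K + + 81 * J)
      B′ K J = - (+ 27 + + 81 * K + + 27 * J)
      S₂ = conv (shifted A B) (suc n)
      S₁ = conv (shifted A′ B′) n
      cube : ∀ K J x → (+ 2 + (K + J - + 2)) * (+ 2 + (K + J - + 2)) * (+ 2 + (K + J - + 2)) * x
                     ≡ (K * K * (K + + 3 * J) + J * J * (+ 3 * K + J)) * x
      cube = solve-∀
      middle : ∀ K J x →
        - (+ 3 * (+ 2 * (K + J - + 1) + + 3) * (+ 9 * (K + J - + 1) * (K + J - + 1) + + 27 * (K + J - + 1) + + 22)) * x
          + (+ 3 * (+ 3 * K + + 1) * (+ 3 * K + + 2) * ((+ 1 + K) + + 3 * J)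
             + + 3 * (+ 3 * J + + 1) * (+ 3 * J + + 2) * (+ 3 * K + (+ 1 + J))) * x
        ≡ (K * K * - (+ 27 + + 27 * K + + 81 * J) + J * J * - (+ 27 + + 81 * K + + 27 * J)) * x
      middle = solve-∀
      bottom : ∀ K J x →
        + 81 * ((K + J) + + 1) * (+ 3 * (K + J) + + 2) * (+ 3 * (K + J) + + 4) * x
          + (+ 3 * (+ 3 * K + + 1) * (+ 3 * K + + 2) * - (+ 27 + + 27 * (+ 1 + K) + + 81 * J)
             + + 3 * (+ 3 * J + + 1) * (+ 3 * J + + 2) * - (+ 27 + + 81 * K + + 27 * (+ 1 + J))) * x
        ≡ 0ℤ
      bottom = solve-∀
      step₂ : p₂ N * X (suc (suc n)) ≡ S₂
      step₂ = begin
        p₂ N * X (suc (suc n))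
          ≡⟨ *-distribˡ-conv (suc (suc n)) (p₂ N) aa ⟩
        conv (λ k j → p₂ N * (a k * a j)) (suc (suc n))
          ≡⟨ conv-cong (suc (suc n)) (λ k j k+j≡2+n →
               trans (cong (λ M → p₂ M * (a k * a j)) (k+j≡d+n⇒n≡k+j-d k j 2 k+j≡2+n)) (cube (+ k) (+ j) (a k * a j))) ⟩
        conv (weighted A B) (suc (suc n))
          ≡⟨ conv-shift (suc n) A B ⟩
        S₂ ∎
      step₁ : p₁ N * X (suc n) + S₂ ≡ S₁
      step₁ = trans (conv-linear (suc n) (p₁ N) aa (shifted A B) (weighted A′ B′) (λ k j k+j≡1+n →
                       trans (cong (λ M → p₁ M * (a k * a j) + shifted A B k j) (k+j≡d+n⇒n≡k+j-d k j 1 k+j≡1+n))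
                             (middle (+ k) (+ j) (a k * a j))))
                    (conv-shift n A′ B′)
      step₀ : p₀ N * X n + S₁ ≡ 0ℤ
      step₀ = trans (conv-linear n (p₀ N) aa (shifted A′ B′) (λ _ _ → 0ℤ) (λ k j k+j≡n →
                       trans (cong (λ M → p₀ M * (a k * a j) + shifted A′ B′ k j) (cong +_ (sym k+j≡n)))
                             (bottom (+ k) (+ j) (a k * a j))))
                    (conv-zero n)

  -- For t (the right-hand summand) and n = k + i this is p₀ t(k,i) + p₁ t(k,i+1) + p₂ t(k,i+2) = h(k+1) − h k
  -- with h k = −(n+2) k² t(k,n+2−k), from the three relations of t. Multiplying by D = (i+1)(i+2)(k+1)²
  -- turns the difference of the two sides into a combination of the three hypotheses.
  telescoping-certificate : ∀ k i (x₀ x₁ x₂ y : ℤ) →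
    + suc i * x₁ ≡ - + 27 * (+ k - + i) * x₀ →
    + suc (suc i) * x₂ ≡ - + 27 * (+ k - + i - + 1) * x₁ →
    + suc i * (+ suc k * + suc k) * y ≡ - + 162 * (+ 2 * + k + + 1) * (+ 3 * + k + + 1) * (+ 3 * + k + + 2) * x₀ →
    p₀ (+ k + + i) * x₀ + p₁ (+ k + + i) * x₁ + p₂ (+ k + + i) * x₂
      ≡ - (+ 2 + (+ k + + i)) * (+ suc k * + suc k * y) - - (+ 2 + (+ k + + i)) * (+ k * + k * x₂)
  telescoping-certificate k i x₀ x₁ x₂ y e₁ e₂ e₃ =
    ℤP.i-j≡0⇒i≡j L R (ℤP.*-cancelˡ-≡ D (L - R) 0ℤ (begin
      D * (L - R)               ≡⟨ combination K I x₀ x₁ x₂ y ⟩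
      α * d₁ + β * d₂ + γ * d₃  ≡⟨ cong₂ _+_ (cong₂ _+_ (cong (α *_) (vanish e₁)) (cong (β *_) (vanish e₂)))
                                           (cong (γ *_) (vanish e₃)) ⟩
      α * 0ℤ + β * 0ℤ + γ * 0ℤ  ≡⟨ zeros α β γ ⟩
      0ℤ                        ≡⟨ ℤP.*-zeroʳ D ⟨
      D * 0ℤ                    ∎))
    where
    K I N L R D α β γ d₁ d₂ d₃ : ℤ
    K = + k
    I = + i
    N = K + I
    L = p₀ N * x₀ + p₁ N * x₁ + p₂ N * x₂
    R = - (+ 2 + N) * ((+ 1 + K) * (+ 1 + K) * y) - - (+ 2 + N) * (K * K * x₂)
    D = (+ 1 + I) * (+ 2 + I) * ((+ 1 + K) * (+ 1 + K))
    d₁ = (+ 1 + I) * x₁ - - + 27 * (K - I) * x₀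
    d₂ = (+ 2 + I) * x₂ - - + 27 * (K - I - + 1) * x₁
    d₃ = (+ 1 + I) * ((+ 1 + K) * (+ 1 + K)) * y - - + 162 * (+ 2 * K + + 1) * (+ 3 * K + + 1) * (+ 3 * K + + 2) * x₀
    β = (+ 1 + I) * ((+ 1 + K) * (+ 1 + K)) * (p₂ N - (+ 2 + N) * (K * K))
    α = (+ 2 + I) * ((+ 1 + K) * (+ 1 + K)) * p₁ N + ((+ 1 + K) * (+ 1 + K)) * (p₂ N - (+ 2 + N) * (K * K)) * (- + 27 * (K - I - + 1))
    γ = (+ 2 + I) * ((+ 1 + K) * (+ 1 + K)) * (+ 2 + N)
    vanish : ∀ {u v} → u ≡ v → u - v ≡ 0ℤ
    vanish {u} refl = ℤP.+-inverseʳ u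
    zeros : ∀ a b c → a * 0ℤ + b * 0ℤ + c * 0ℤ ≡ 0ℤ
    zeros = solve-∀
    combination : ∀ K I x₀ x₁ x₂ y →
      (+ 1 + I) * (+ 2 + I) * ((+ 1 + K) * (+ 1 + K)) *
        ((+ 81 * ((K + I) + + 1) * (+ 3 * (K + I) + + 2) * (+ 3 * (K + I) + + 4) * x₀
          + - (+ 3 * (+ 2 * (K + I) + + 3) * (+ 9 * (K + I) * (K + I) + + 27 * (K + I) + + 22)) * x₁
          + (+ 2 + (K + I)) * (+ 2 + (K + I)) * (+ 2 + (K + I)) * x₂)
         - (- (+ 2 + (K + I)) * ((+ 1 + K) * (+ 1 + K) * y) - - (+ 2 + (K + I)) * (K * K * x₂)))
      ≡ ((+ 2 + I) * ((+ 1 + K) * (+ 1 + K)) * - (+ 3 * (+ 2 * (K + I) + + 3) * (+ 9 * (K + I) * (K + I) + + 27 * (K + I) + + 22))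
           + ((+ 1 + K) * (+ 1 + K)) * ((+ 2 + (K + I)) * (+ 2 + (K + I)) * (+ 2 + (K + I)) - (+ 2 + (K + I)) * (K * K))
             * (- + 27 * (K - I - + 1)))
          * ((+ 1 + I) * x₁ - - + 27 * (K - I) * x₀)
        + (+ 1 + I) * ((+ 1 + K) * (+ 1 + K)) * ((+ 2 + (K + I)) * (+ 2 + (K + I)) * (+ 2 + (K + I)) - (+ 2 + (K + I)) * (K * K))
          * ((+ 2 + I) * x₂ - - + 27 * (K - I - + 1) * x₁)
        + (+ 2 + I) * ((+ 1 + K) * (+ 1 + K)) * (+ 2 + (K + I))
          * ((+ 1 + I) * ((+ 1 + K) * (+ 1 + K)) * y - - + 162 * (+ 2 * K + + 1) * (+ 3 * K + + 1) * (+ 3 * K + + 2) * x₀)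
    combination = solve-∀

  module _ (t : ℕ → ℕ → ℤ)
           (t-stepⁱ : ∀ k i → + suc i * t k (suc i) ≡ - + 27 * (+ k - + i) * t k i)
           (t-stepᵏⁱ : ∀ k i → + suc i * (+ suc k * + suc k) * t (suc k) (suc i)
                             ≡ - + 162 * (+ 2 * + k + + 1) * (+ 3 * + k + + 1) * (+ 3 * + k + + 2) * t k i)
           (t-stepᵏ : ∀ k → + suc k * + suc k * + suc k * t (suc k) 0
                            ≡ + 6 * (+ 2 * + k + + 1) * (+ 3 * + k + + 1) * (+ 3 * + k + + 2) * t k 0) where

    convolution-recurrence : SolvesP (conv t)
    convolution-recurrence n = begin
      p₂ N * Y (suc (suc n)) + p₁ N * Y (suc n) + p₀ N * Y n
        ≡⟨ cong₂ (λ u v → p₂ N * u + p₁ N * v + p₀ N * Y n)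
             (trans (conv-sucʳ (suc n) t) (cong (_+ s₂) (conv-sucʳ n t₁))) (conv-sucʳ n t) ⟩
      p₂ N * (conv t₂ n + s₁ + s₂) + p₁ N * (conv t₁ n + b) + p₀ N * conv t n
        ≡⟨ regroup (p₀ N) (p₁ N) (p₂ N) (conv t n) (conv t₁ n) (conv t₂ n) b s₁ s₂ ⟩
      (p₀ N * conv t n + p₁ N * conv t₁ n + p₂ N * conv t₂ n) + (p₁ N * b + p₂ N * (s₁ + s₂))
        ≡⟨ cong (_+ (p₁ N * b + p₂ N * (s₁ + s₂))) interior ⟩
      h (suc n) - h 0 + (p₁ N * b + p₂ N * (s₁ + s₂))
        ≡⟨ cong₂ (λ u v → u - v + (p₁ N * b + p₂ N * (s₁ + s₂))) h-last (ℤP.*-zeroʳ (- (+ 2 + N))) ⟩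
      - (+ 2 + N) * ((+ 1 + N) * (+ 1 + N) * s₁) - 0ℤ + (p₁ N * b + p₂ N * (s₁ + s₂))
        ≡⟨ boundary ⟩
      0ℤ ∎
      where
      N = + n
      Y = conv t
      t₁ t₂ : ℕ → ℕ → ℤ
      t₁ k j = t k (suc j)
      t₂ k j = t k (suc (suc j))
      b s₁ s₂ : ℤ
      b  = t (suc n) 0
      s₁ = t (suc n) 1
      s₂ = t (suc (suc n)) 0
      h : ℕ → ℤ
      h k = - (+ 2 + N) * (+ k * + k * t k (suc (suc n) ℕ.∸ k))
      h-last : h (suc n) ≡ - (+ 2 + N) * ((+ 1 + N) * (+ 1 + N) * s₁)
      h-last = cong (λ j → - (+ 2 + N) * ((+ 1 + N) * (+ 1 + N) * t (suc n) j))
                    (trans (ℕP.+-∸-assoc 1 (ℕP.≤-refl {n})) (cong suc (ℕP.n∸n≡0 n)))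
      regroup : ∀ q₀ q₁ q₂ y₀ y₁ y₂ b s₁ s₂ →
        q₂ * (y₂ + s₁ + s₂) + q₁ * (y₁ + b) + q₀ * y₀
          ≡ (q₀ * y₀ + q₁ * y₁ + q₂ * y₂) + (q₁ * b + q₂ * (s₁ + s₂))
      regroup = solve-∀
      step-at : ∀ k → k ≤ n →
                p₀ N * t k (n ℕ.∸ k) + p₁ N * t₁ k (n ℕ.∸ k) + p₂ N * t₂ k (n ℕ.∸ k) ≡ h (suc k) - h k
      step-at k k≤n = begin
        p₀ N * t k i + p₁ N * t k (suc i) + p₂ N * t k (suc (suc i))
          ≡⟨ cong (λ M → p₀ M * t k i + p₁ M * t k (suc i) + p₂ M * t k (suc (suc i))) k+i≡n ⟨
        p₀ (+ k + + i) * t k i + p₁ (+ k + + i) * t k (suc i) + p₂ (+ k + + i) * t k (suc (suc i))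
          ≡⟨ telescoping-certificate k i _ _ _ _ (t-stepⁱ k i)
               (trans (t-stepⁱ k (suc i)) (cong (λ c → - + 27 * c * t k (suc i)) (minus-suc (+ k) (+ i))))
               (t-stepᵏⁱ k i) ⟩
        - (+ 2 + (+ k + + i)) * (+ suc k * + suc k * t (suc k) (suc i)) - - (+ 2 + (+ k + + i)) * (+ k * + k * t k (suc (suc i)))
          ≡⟨ cong₂ (λ M j → - (+ 2 + M) * (+ suc k * + suc k * t (suc k) j) - - (+ 2 + M) * (+ k * + k * t k (suc (suc i))))
                   k+i≡n (sym (ℕP.+-∸-assoc 1 k≤n)) ⟩
        - (+ 2 + N) * (+ suc k * + suc k * t (suc k) (suc n ℕ.∸ k)) - - (+ 2 + N) * (+ k * + k * t k (suc (suc i)))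
          ≡⟨ cong (λ j → - (+ 2 + N) * (+ suc k * + suc k * t (suc k) (suc n ℕ.∸ k)) - - (+ 2 + N) * (+ k * + k * t k j))
                  (ℕP.+-∸-assoc 2 k≤n) ⟨
        h (suc k) - h k ∎
        where
        i = n ℕ.∸ k
        k+i≡n : + k + + i ≡ N
        k+i≡n = cong +_ (ℕP.m+[n∸m]≡n k≤n)
        minus-suc : ∀ K I → K - (+ 1 + I) ≡ K - I - + 1
        minus-suc = solve-∀
      interior : p₀ N * conv t n + p₁ N * conv t₁ n + p₂ N * conv t₂ n ≡ h (suc n) - h 0
      interior = begin
        p₀ N * conv t n + p₁ N * conv t₁ n + p₂ N * conv t₂ n
          ≡⟨ cong₂ _+_ (cong₂ _+_ (*-distribˡ-conv n (p₀ N) t) (*-distribˡ-conv n (p₁ N) t₁))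
                       (*-distribˡ-conv n (p₂ N) t₂) ⟩
        conv (λ k j → p₀ N * t k j) n + conv (λ k j → p₁ N * t₁ k j) n + conv (λ k j → p₂ N * t₂ k j) n
          ≡⟨ cong (_+ conv (λ k j → p₂ N * t₂ k j) n) (conv-+ n (λ k j → p₀ N * t k j) (λ k j → p₁ N * t₁ k j)) ⟨
        conv (λ k j → p₀ N * t k j + p₁ N * t₁ k j) n + conv (λ k j → p₂ N * t₂ k j) n
          ≡⟨ conv-+ n (λ k j → p₀ N * t k j + p₁ N * t₁ k j) (λ k j → p₂ N * t₂ k j) ⟨
        sum≤ n (λ k → p₀ N * t k (n ℕ.∸ k) + p₁ N * t₁ k (n ℕ.∸ k) + p₂ N * t₂ k (n ℕ.∸ k))
          ≡⟨ sum≤-cong n step-at ⟩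
        sum≤ n (λ k → h (suc k) - h k)
          ≡⟨ sum≤-telescope n h ⟩
        h (suc n) - h 0 ∎
      s₁≡ : s₁ ≡ - + 27 * (+ 1 + N - 0ℤ) * b
      s₁≡ = trans (sym (ℤP.*-identityˡ s₁)) (t-stepⁱ (suc n) 0)
      boundary : - (+ 2 + N) * ((+ 1 + N) * (+ 1 + N) * s₁) - 0ℤ + (p₁ N * b + p₂ N * (s₁ + s₂)) ≡ 0ℤ
      boundary = begin
        - (+ 2 + N) * ((+ 1 + N) * (+ 1 + N) * s₁) - 0ℤ + (p₁ N * b + p₂ N * (s₁ + s₂))
          ≡⟨ expand N b s₁ s₂ ⟩
        - (+ 2 + N) * ((+ 1 + N) * (+ 1 + N) * s₁) + (p₁ N * b + p₂ N * s₁) + p₂ N * s₂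
          ≡⟨ cong₂ (λ u v → - (+ 2 + N) * ((+ 1 + N) * (+ 1 + N) * u) + (p₁ N * b + p₂ N * u) + v)
                   s₁≡ (t-stepᵏ (suc n)) ⟩
        - (+ 2 + N) * ((+ 1 + N) * (+ 1 + N) * (- + 27 * (+ 1 + N - 0ℤ) * b)) + (p₁ N * b + p₂ N * (- + 27 * (+ 1 + N - 0ℤ) * b))
          + + 6 * (+ 2 * (+ 1 + N) + + 1) * (+ 3 * (+ 1 + N) + + 1) * (+ 3 * (+ 1 + N) + + 2) * b
          ≡⟨ cancel N b ⟩
        0ℤ ∎
        where
        expand : ∀ N b s₁ s₂ →
          - (+ 2 + N) * ((+ 1 + N) * (+ 1 + N) * s₁) - 0ℤ
            + (- (+ 3 * (+ 2 * N + + 3) * (+ 9 * N * N + + 27 * N + + 22)) * b + (+ 2 + N) * (+ 2 + N) * (+ 2 + N) * (s₁ + s₂))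
          ≡ - (+ 2 + N) * ((+ 1 + N) * (+ 1 + N) * s₁)
            + (- (+ 3 * (+ 2 * N + + 3) * (+ 9 * N * N + + 27 * N + + 22)) * b + (+ 2 + N) * (+ 2 + N) * (+ 2 + N) * s₁)
            + (+ 2 + N) * (+ 2 + N) * (+ 2 + N) * s₂
        expand = solve-∀
        cancel : ∀ N b →
          - (+ 2 + N) * ((+ 1 + N) * (+ 1 + N) * (- + 27 * (+ 1 + N - 0ℤ) * b))
            + (- (+ 3 * (+ 2 * N + + 3) * (+ 9 * N * N + + 27 * N + + 22)) * b
               + (+ 2 + N) * (+ 2 + N) * (+ 2 + N) * (- + 27 * (+ 1 + N - 0ℤ) * b))
            + + 6 * (+ 2 * (+ 1 + N) + + 1) * (+ 3 * (+ 1 + N) + + 1) * (+ 3 * (+ 1 + N) + + 2) * b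
          ≡ 0ℤ
        cancel = solve-∀

  a : ℕ → ℤ
  a k = + trinomial k

  a-rec : ∀ k → + suc k * + suc k * a (suc k) ≡ c₃ (+ k) * a k
  a-rec k = begin
    + suc k * + suc k * a (suc k)                ≡⟨ cong (_* a (suc k)) (ℤP.pos-* (suc k) (suc k)) ⟨
    + (suc k ℕ.* suc k) * a (suc k)              ≡⟨ ℤP.pos-* (suc k ℕ.* suc k) (trinomial (suc k)) ⟨
    + (suc k ℕ.* suc k ℕ.* trinomial (suc k))    ≡⟨ cong +_ (trinomial-rec k) ⟩
    + (c ℕ.* trinomial k)                        ≡⟨ ℤP.pos-* c (trinomial k) ⟩
    + c * a k                                    ≡⟨ cong (_* a k) c≡c₃ ⟩
    c₃ (+ k) * a k                               ∎
    where
    c = 3 ℕ.* (3 ℕ.* k ℕ.+ 1) ℕ.* (3 ℕ.* k ℕ.+ 2)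
    c≡c₃ : + c ≡ c₃ (+ k)
    c≡c₃ = begin
      + c                                              ≡⟨ ℤP.pos-* (3 ℕ.* (3 ℕ.* k ℕ.+ 1)) (3 ℕ.* k ℕ.+ 2) ⟩
      + (3 ℕ.* (3 ℕ.* k ℕ.+ 1)) * + (3 ℕ.* k ℕ.+ 2)    ≡⟨ cong (_* + (3 ℕ.* k ℕ.+ 2)) (ℤP.pos-* 3 (3 ℕ.* k ℕ.+ 1)) ⟩
      + 3 * + (3 ℕ.* k ℕ.+ 1) * + (3 ℕ.* k ℕ.+ 2)      ≡⟨ cong (λ y → + 3 * (y + + 1) * (y + + 2)) (ℤP.pos-* 3 k) ⟩
      c₃ (+ k)                                         ∎

  central-rec-ℤ : ∀ k → + suc k * + central (suc k) ≡ + 2 * (+ 2 * + k + + 1) * + central k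
  central-rec-ℤ k = begin
    + suc k * + central (suc k)                  ≡⟨ ℤP.pos-* (suc k) _ ⟨
    + (suc k ℕ.* central (suc k))                ≡⟨ cong +_ (central-rec k) ⟩
    + (2 ℕ.* (2 ℕ.* k ℕ.+ 1) ℕ.* central k)      ≡⟨ ℤP.pos-* (2 ℕ.* (2 ℕ.* k ℕ.+ 1)) (central k) ⟩
    + (2 ℕ.* (2 ℕ.* k ℕ.+ 1)) * + central k      ≡⟨ cong (_* + central k) (ℤP.pos-* 2 (2 ℕ.* k ℕ.+ 1)) ⟩
    + 2 * + (2 ℕ.* k ℕ.+ 1) * + central k        ≡⟨ cong (λ y → + 2 * (y + + 1) * + central k) (ℤP.pos-* 2 k) ⟩
    + 2 * (+ 2 * + k + + 1) * + central k        ∎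

  absorption-ℤ : ∀ k i → + suc i * + (suc k C suc i) ≡ + suc k * + (k C i)
  absorption-ℤ k i = trans (sym (ℤP.pos-* (suc i) _)) (trans (cong +_ (absorption k i)) (ℤP.pos-* (suc k) _))

  lowering-ℤ : ∀ k i → + suc i * + (k C suc i) ≡ (+ k - + i) * + (k C i)
  lowering-ℤ k i = begin
    + suc i * + (k C suc i)                              ≡⟨ move (+ suc i * + (k C suc i)) (+ i * + (k C i)) ⟩
    + suc i * + (k C suc i) + + i * + (k C i) - + i * + (k C i)
                                                         ≡⟨ cong (_- + i * + (k C i)) sum ⟩
    + k * + (k C i) - + i * + (k C i)                    ≡⟨ factor (+ k) (+ i) (+ (k C i)) ⟩
    (+ k - + i) * + (k C i)                              ∎
    where
    move : ∀ x y → x ≡ x + y - y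
    move = solve-∀
    factor : ∀ K I c → K * c - I * c ≡ (K - I) * c
    factor = solve-∀
    sum : + suc i * + (k C suc i) + + i * + (k C i) ≡ + k * + (k C i)
    sum = trans (sym (cong₂ _+_ (ℤP.pos-* (suc i) _) (ℤP.pos-* i _)))
                (trans (cong +_ (lowering k i)) (ℤP.pos-* k _))

  b : ℕ → ℤ
  b k = + central k * a k

  t : ℕ → ℕ → ℤ
  t k i = (- + 27) ℤ.^ i * + (k C i) * b k

  t-stepⁱ : ∀ k i → + suc i * t k (suc i) ≡ - + 27 * (+ k - + i) * t k i
  t-stepⁱ k i = begin
    + suc i * ((- + 27) * P * + (k C suc i) * b k)       ≡⟨ reorder (+ suc i) P (+ (k C suc i)) (b k) ⟩
    - + 27 * P * b k * (+ suc i * + (k C suc i))         ≡⟨ cong (- + 27 * P * b k *_) (lowering-ℤ k i) ⟩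
    - + 27 * P * b k * ((+ k - + i) * + (k C i))         ≡⟨ regroup (+ k - + i) P (+ (k C i)) (b k) ⟩
    - + 27 * (+ k - + i) * t k i                         ∎
    where
    P = (- + 27) ℤ.^ i
    reorder : ∀ s p c x → s * (- + 27 * p * c * x) ≡ - + 27 * p * x * (s * c)
    reorder = solve-∀
    regroup : ∀ d p c x → - + 27 * p * x * (d * c) ≡ - + 27 * d * (p * c * x)
    regroup = solve-∀

  b-rec : ∀ k → + suc k * + suc k * + suc k * b (suc k)
                ≡ + 6 * (+ 2 * + k + + 1) * (+ 3 * + k + + 1) * (+ 3 * + k + + 2) * b k
  b-rec k = begin
    + suc k * + suc k * + suc k * (+ central (suc k) * a (suc k))
      ≡⟨ split (+ suc k) (+ central (suc k)) (a (suc k)) ⟩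
    (+ suc k * + central (suc k)) * (+ suc k * + suc k * a (suc k))
      ≡⟨ cong₂ _*_ (central-rec-ℤ k) (a-rec k) ⟩
    (+ 2 * (+ 2 * + k + + 1) * + central k) * (c₃ (+ k) * a k)
      ≡⟨ merge (+ k) (+ central k) (a k) ⟩
    + 6 * (+ 2 * + k + + 1) * (+ 3 * + k + + 1) * (+ 3 * + k + + 2) * b k ∎
    where
    split : ∀ s c x → s * s * s * (c * x) ≡ (s * c) * (s * s * x)
    split = solve-∀
    merge : ∀ K c x → (+ 2 * (+ 2 * K + + 1) * c) * (+ 3 * (+ 3 * K + + 1) * (+ 3 * K + + 2) * x)
                    ≡ + 6 * (+ 2 * K + + 1) * (+ 3 * K + + 1) * (+ 3 * K + + 2) * (c * x)
    merge = solve-∀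

  t-stepᵏ : ∀ k → + suc k * + suc k * + suc k * t (suc k) 0
                  ≡ + 6 * (+ 2 * + k + + 1) * (+ 3 * + k + + 1) * (+ 3 * + k + + 2) * t k 0
  t-stepᵏ k = trans (cong (+ suc k * + suc k * + suc k *_) (ℤP.*-identityˡ (b (suc k))))
                    (trans (b-rec k) (cong (+ 6 * (+ 2 * + k + + 1) * (+ 3 * + k + + 1) * (+ 3 * + k + + 2) *_)
                                        (sym (ℤP.*-identityˡ (b k)))))

  t-stepᵏⁱ : ∀ k i → + suc i * (+ suc k * + suc k) * t (suc k) (suc i)
                   ≡ - + 162 * (+ 2 * + k + + 1) * (+ 3 * + k + + 1) * (+ 3 * + k + + 2) * t k i
  t-stepᵏⁱ k i = ℤP.*-cancelˡ-≡ (+ suc k) _ _ (begin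
    + suc k * (+ suc i * (+ suc k * + suc k) * ((- + 27) * P * + (suc k C suc i) * (+ central (suc k) * a (suc k))))
      ≡⟨ split (+ suc k) (+ suc i) P (+ (suc k C suc i)) (+ central (suc k)) (a (suc k)) ⟩
    - + 27 * P * (+ suc i * + (suc k C suc i)) * (+ suc k * + central (suc k)) * (+ suc k * + suc k * a (suc k))
      ≡⟨ cong₂ (λ u v → - + 27 * P * u * v * (+ suc k * + suc k * a (suc k))) (absorption-ℤ k i) (central-rec-ℤ k) ⟩
    - + 27 * P * (+ suc k * + (k C i)) * (+ 2 * (+ 2 * + k + + 1) * + central k) * (+ suc k * + suc k * a (suc k))
      ≡⟨ cong (- + 27 * P * (+ suc k * + (k C i)) * (+ 2 * (+ 2 * + k + + 1) * + central k) *_) (a-rec k) ⟩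
    - + 27 * P * (+ suc k * + (k C i)) * (+ 2 * (+ 2 * + k + + 1) * + central k) * (c₃ (+ k) * a k)
      ≡⟨ merge (+ k) P (+ (k C i)) (+ central k) (a k) ⟩
    + suc k * (- + 162 * (+ 2 * + k + + 1) * (+ 3 * + k + + 1) * (+ 3 * + k + + 2) * t k i) ∎)
    where
    P = (- + 27) ℤ.^ i
    split : ∀ s r p c q x → s * (r * (s * s) * (- + 27 * p * c * (q * x)))
                          ≡ - + 27 * p * (r * c) * (s * q) * (s * s * x)
    split = solve-∀
    merge : ∀ K p c q x → - + 27 * p * ((+ 1 + K) * c) * (+ 2 * (+ 2 * K + + 1) * q) * (+ 3 * (+ 3 * K + + 1) * (+ 3 * K + + 2) * x)
                        ≡ (+ 1 + K) * (- + 162 * (+ 2 * K + + 1) * (+ 3 * K + + 1) * (+ 3 * K + + 2) * (p * c * (q * x)))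
    merge = solve-∀

  convolution-identity : ∀ n → conv (λ k j → a k * a j) n ≡ conv t n
  convolution-identity =
    recurrence-unique {λ n → p₀ (+ n)} {λ n → p₁ (+ n)} {λ n → p₂ (+ n)} (λ _ → _)
    (self-convolution-recurrence a a-rec) (convolution-recurrence t t-stepⁱ t-stepᵏⁱ t-stepᵏ) refl refl


-- Passage to ℚ

module _ where

  open import Data.Rational using (mkℚ; _+_; _*_; -_; _-_; _/_)
  import Data.Nat.Coprimality as Coprime
  open import Data.Rational.Unnormalised.Base using (*≡*; mkℚᵘ)
  open import Data.Rational.Solver using (module +-*-Solver)
  open +-*-Solver using (solve; con; _:+_; _:*_; _:-_; :-_; _:=_)
  open import Data.Nat.Tactic.RingSolver using () renaming (solve-∀ to ℕ-solve-∀)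

  ι : ℤ → ℚ
  ι z = z / 1

  ι-mkℚ : ∀ z → ι z ≡ mkℚ z 0 (Coprime.sym (Coprime.1-coprimeTo ℤ.∣ z ∣))
  ι-mkℚ z = ℚP.fromℚᵘ-toℚᵘ (mkℚ z 0 (Coprime.sym (Coprime.1-coprimeTo ℤ.∣ z ∣)))

  ι-homo-+ : ∀ x y → ι (x ℤ.+ y) ≡ ι x + ι y
  ι-homo-+ x y rewrite ι-mkℚ x | ι-mkℚ y =
    sym (cong (_/ 1) (cong₂ ℤ._+_ (ℤP.*-identityʳ x) (ℤP.*-identityʳ y)))

  ι-homo-* : ∀ x y → ι (x ℤ.* y) ≡ ι x * ι y
  ι-homo-* x y rewrite ι-mkℚ x | ι-mkℚ y = refl

  ⟦⟧-homo-* : ∀ m n → ⟦ m ℕ.* n ⟧ ≡ ⟦ m ⟧ * ⟦ n ⟧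
  ⟦⟧-homo-* m n = trans (cong ι (ℤP.pos-* m n)) (ι-homo-* (+ m) (+ n))

  Σ≤-cong : ∀ n {f g : ℕ → ℚ} → (∀ k → k ≤ n → f k ≡ g k) → Σ≤ n f ≡ Σ≤ n g
  Σ≤-cong zero    f≗g = f≗g 0 z≤n
  Σ≤-cong (suc n) f≗g =
    cong₂ _+_ (Σ≤-cong n (λ k k≤n → f≗g k (ℕP.m≤n⇒m≤1+n k≤n))) (f≗g (suc n) ℕP.≤-refl)

  *-distribˡ-Σ≤ : ∀ n c (f : ℕ → ℚ) → c * Σ≤ n f ≡ Σ≤ n (λ k → c * f k)
  *-distribˡ-Σ≤ zero    c f = refl
  *-distribˡ-Σ≤ (suc n) c f =
    trans (ℚP.*-distribˡ-+ c (Σ≤ n f) (f (suc n))) (cong (_+ c * f (suc n)) (*-distribˡ-Σ≤ n c f))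

  Σ≤-ι : ∀ n (f : ℕ → ℤ) → Σ≤ n (λ k → ι (f k)) ≡ ι (sum≤ n f)
  Σ≤-ι zero    f = refl
  Σ≤-ι (suc n) f = trans (cong (_+ ι (f (suc n))) (Σ≤-ι n f)) (sym (ι-homo-+ (sum≤ n f) (f (suc n))))

  /-ι : ∀ p q c .{{_ : ℕ.NonZero q}} → p ≡ q ℕ.* c → + p / q ≡ ι (+ c)
  /-ι p (suc q) c p≡q*c = ℚP.fromℚᵘ-cong {mkℚᵘ (+ p) q} {mkℚᵘ (+ c) 0} (*≡* (begin
    + p ℤ.* + 1        ≡⟨ ℤP.*-identityʳ (+ p) ⟩
    + p                ≡⟨ cong +_ (trans p≡q*c (ℕP.*-comm (suc q) c)) ⟩
    + (c ℕ.* suc q)    ≡⟨ ℤP.pos-* c (suc q) ⟩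
    + c ℤ.* + suc q    ∎))

  ι-*-inverse : ∀ k → ι (+ suc k) * (+ 1 / suc k) ≡ 1ℚ
  ι-*-inverse k = trans (cong₂ _*_ (ι-mkℚ (+ suc k)) (ℚP.fromℚᵘ-toℚᵘ (mkℚ (+ 1) k (Coprime.1-coprimeTo (suc k)))))
    (ℚP.fromℚᵘ-cong {mkℚᵘ (+ suc k ℤ.* + 1) (k ℕ.+ 0)} {mkℚᵘ (+ 1) 0} (*≡* (begin
      + suc k ℤ.* + 1 ℤ.* + 1    ≡⟨ ℤP.*-identityʳ _ ⟩
      + suc k ℤ.* + 1            ≡⟨ ℤP.*-identityʳ _ ⟩
      + suc k                    ≡⟨ cong (λ m → + suc m) (ℕP.+-identityʳ k) ⟨
      + suc (k ℕ.+ 0)            ≡⟨ ℤP.*-identityˡ _ ⟨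
      + 1 ℤ.* + suc (k ℕ.+ 0)    ∎)))

  trinom≡ι : ∀ k → trinom k ≡ ι (a k)
  trinom≡ι k =
    /-ι ((3 ℕ.* k) !) ((k !) ^ 3) (trinomial k) {{ℕP.m^n≢0 (k !) 3 {{k ℕP.!≢0}}}} (trinomial-factorial k)

  ι-c₃ : ∀ k → ι (c₃ (+ k)) ≡ ⟦ 3 ⟧ * (⟦ 3 ⟧ * ⟦ k ⟧ + 1ℚ) * (⟦ 3 ⟧ * ⟦ k ⟧ + ⟦ 2 ⟧)
  ι-c₃ k = begin
    ι (+ 3 ℤ.* (+ 3 ℤ.* + k ℤ.+ + 1) ℤ.* (+ 3 ℤ.* + k ℤ.+ + 2))
      ≡⟨ ι-homo-* (+ 3 ℤ.* (+ 3 ℤ.* + k ℤ.+ + 1)) (+ 3 ℤ.* + k ℤ.+ + 2) ⟩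
    ι (+ 3 ℤ.* (+ 3 ℤ.* + k ℤ.+ + 1)) * ι (+ 3 ℤ.* + k ℤ.+ + 2)
      ≡⟨ cong₂ _*_ (ι-homo-* (+ 3) (+ 3 ℤ.* + k ℤ.+ + 1)) (ι-homo-+ (+ 3 ℤ.* + k) (+ 2)) ⟩
    ⟦ 3 ⟧ * ι (+ 3 ℤ.* + k ℤ.+ + 1) * (ι (+ 3 ℤ.* + k) + ⟦ 2 ⟧)
      ≡⟨ cong₂ (λ u v → ⟦ 3 ⟧ * u * (v + ⟦ 2 ⟧)) (ι-homo-+ (+ 3 ℤ.* + k) (+ 1)) (ι-homo-* (+ 3) (+ k)) ⟩
    ⟦ 3 ⟧ * (ι (+ 3 ℤ.* + k) + 1ℚ) * (⟦ 3 ⟧ * ⟦ k ⟧ + ⟦ 2 ⟧)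
      ≡⟨ cong (λ u → ⟦ 3 ⟧ * (u + 1ℚ) * (⟦ 3 ⟧ * ⟦ k ⟧ + ⟦ 2 ⟧)) (ι-homo-* (+ 3) (+ k)) ⟩
    ⟦ 3 ⟧ * (⟦ 3 ⟧ * ⟦ k ⟧ + 1ℚ) * (⟦ 3 ⟧ * ⟦ k ⟧ + ⟦ 2 ⟧) ∎

  -- 27 (-1/3 - k) (-2/3 - k) = c₃ k, so both sides have the ratio c₃ k / (k+1)² between consecutive terms.
  gbinom-product : ∀ k → ⟦ 27 ^ k ⟧ * (gbinom (-[1+ 0 ] / 3) k * gbinom (-[1+ 1 ] / 3) k) ≡ ι (a k)
  gbinom-product zero    = refl
  gbinom-product (suc k) = begin
    ⟦ 27 ^ suc k ⟧ * (G₁ * (τ₁ - K) * u * (G₂ * (τ₂ - K) * u))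
      ≡⟨ cong (_* (G₁ * (τ₁ - K) * u * (G₂ * (τ₂ - K) * u))) (⟦⟧-homo-* 27 (27 ^ k)) ⟩
    ⟦ 27 ⟧ * ⟦ 27 ^ k ⟧ * (G₁ * (τ₁ - K) * u * (G₂ * (τ₂ - K) * u))
      ≡⟨ regroup ⟦ 27 ^ k ⟧ G₁ G₂ K u ⟩
    ⟦ 27 ^ k ⟧ * (G₁ * G₂) * (⟦ 3 ⟧ * (⟦ 3 ⟧ * K + 1ℚ) * (⟦ 3 ⟧ * K + ⟦ 2 ⟧)) * u * u
      ≡⟨ cong₂ (λ x y → x * y * u * u) (gbinom-product k) (sym (ι-c₃ k)) ⟩
    ι (a k) * ι (c₃ (+ k)) * u * u
      ≡⟨ cong (λ x → x * u * u) a-rec-ℚ ⟩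
    S * S * ι (a (suc k)) * u * u
      ≡⟨ cancel S (ι (a (suc k))) u ⟩
    ι (a (suc k)) * ((S * u) * (S * u))
      ≡⟨ cong (λ x → ι (a (suc k)) * (x * x)) (ι-*-inverse k) ⟩
    ι (a (suc k)) * (1ℚ * 1ℚ)
      ≡⟨ ℚP.*-identityʳ (ι (a (suc k))) ⟩
    ι (a (suc k)) ∎
    where
    τ₁ = -[1+ 0 ] / 3
    τ₂ = -[1+ 1 ] / 3
    K = ⟦ k ⟧
    u = + 1 / suc k
    S = ι (+ suc k)
    a-rec-ℚ : ι (a k) * ι (c₃ (+ k)) ≡ S * S * ι (a (suc k))
    a-rec-ℚ = begin
      ι (a k) * ι (c₃ (+ k))                    ≡⟨ ι-homo-* (a k) (c₃ (+ k)) ⟨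
      ι (a k ℤ.* c₃ (+ k))                      ≡⟨ cong ι (ℤP.*-comm (a k) (c₃ (+ k))) ⟩
      ι (c₃ (+ k) ℤ.* a k)                      ≡⟨ cong ι (a-rec k) ⟨
      ι (+ suc k ℤ.* + suc k ℤ.* a (suc k))     ≡⟨ ι-homo-* (+ suc k ℤ.* + suc k) (a (suc k)) ⟩
      ι (+ suc k ℤ.* + suc k) * ι (a (suc k))   ≡⟨ cong (_* ι (a (suc k))) (ι-homo-* (+ suc k) (+ suc k)) ⟩
      S * S * ι (a (suc k))                     ∎
    G₁ = gbinom τ₁ k
    G₂ = gbinom τ₂ k
    regroup : ∀ T G₁ G₂ K u → ⟦ 27 ⟧ * T * (G₁ * (τ₁ - K) * u * (G₂ * (τ₂ - K) * u))
                            ≡ T * (G₁ * G₂) * (⟦ 3 ⟧ * (⟦ 3 ⟧ * K + 1ℚ) * (⟦ 3 ⟧ * K + ⟦ 2 ⟧)) * u * u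
    regroup = solve 5 (λ T G₁ G₂ K u →
      con ⟦ 27 ⟧ :* T :* (G₁ :* (con τ₁ :- K) :* u :* (G₂ :* (con τ₂ :- K) :* u))
        := T :* (G₁ :* G₂) :* (con ⟦ 3 ⟧ :* (con ⟦ 3 ⟧ :* K :+ con 1ℚ) :* (con ⟦ 3 ⟧ :* K :+ con ⟦ 2 ⟧)) :* u :* u) refl
    cancel : ∀ S A u → S * S * A * u * u ≡ A * ((S * u) * (S * u))
    cancel = solve 3 (λ S A u → S :* S :* A :* u :* u := A :* ((S :* u) :* (S :* u))) refl

  sign-suc-suc : ∀ m → sign (suc (suc m)) ≡ sign m
  sign-suc-suc zero    = refl
  sign-suc-suc (suc m) = cong -_ (sign-suc-suc m)

  sign-+-even : ∀ m k → sign (m ℕ.+ (k ℕ.+ k)) ≡ sign m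
  sign-+-even m zero    = cong sign (ℕP.+-identityʳ m)
  sign-+-even m (suc k) = begin
    sign (m ℕ.+ (suc k ℕ.+ suc k))      ≡⟨ cong sign (shift m k) ⟩
    sign (suc (suc (m ℕ.+ (k ℕ.+ k))))  ≡⟨ sign-suc-suc (m ℕ.+ (k ℕ.+ k)) ⟩
    sign (m ℕ.+ (k ℕ.+ k))              ≡⟨ sign-+-even m k ⟩
    sign m                              ∎
    where
    shift : ∀ m k → m ℕ.+ (suc k ℕ.+ suc k) ≡ suc (suc (m ℕ.+ (k ℕ.+ k)))
    shift = ℕ-solve-∀

  sign-*-27^ : ∀ i → sign i * ⟦ 27 ^ i ⟧ ≡ ι ((ℤ.- + 27) ℤ.^ i)
  sign-*-27^ zero    = refl
  sign-*-27^ (suc i) = begin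
    - sign i * ⟦ 27 ℕ.* 27 ^ i ⟧                  ≡⟨ cong (- sign i *_) (⟦⟧-homo-* 27 (27 ^ i)) ⟩
    - sign i * (⟦ 27 ⟧ * ⟦ 27 ^ i ⟧)              ≡⟨ negate (sign i) ⟦ 27 ^ i ⟧ ⟩
    ι (ℤ.- + 27) * (sign i * ⟦ 27 ^ i ⟧)          ≡⟨ cong (ι (ℤ.- + 27) *_) (sign-*-27^ i) ⟩
    ι (ℤ.- + 27) * ι ((ℤ.- + 27) ℤ.^ i)           ≡⟨ ι-homo-* (ℤ.- + 27) ((ℤ.- + 27) ℤ.^ i) ⟨
    ι ((ℤ.- + 27) ℤ.^ suc i)                      ∎
    where
    negate : ∀ s x → - s * (⟦ 27 ⟧ * x) ≡ ι (ℤ.- + 27) * (s * x)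
    negate = solve 2 (λ s x → (:- s) :* (con ⟦ 27 ⟧ :* x) := con (ι (ℤ.- + 27)) :* (s :* x)) refl

  module _ (n : ℕ) where

    private
      τ₁ τ₂ : ℚ
      τ₁ = -[1+ 0 ] / 3
      τ₂ = -[1+ 1 ] / 3

    summand : ℕ → ℚ
    summand k = sign (n ℕ.+ k) * binomℚ n k * binomℚ (2 ℕ.* k) n * gbinom τ₁ k * gbinom τ₂ k

    binomℚ-revision : ∀ {k} → k ≤ n → binomℚ n k * binomℚ (2 ℕ.* k) n ≡ ⟦ k C (n ∸ k) ⟧ * ⟦ central k ⟧
    binomℚ-revision {k} k≤n = begin
      binomℚ n k * binomℚ (2 ℕ.* k) n    ≡⟨ ⟦⟧-homo-* (n C k) ((2 ℕ.* k) C n) ⟨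
      ⟦ (n C k) ℕ.* ((2 ℕ.* k) C n) ⟧    ≡⟨ cong ⟦_⟧ (C-revision-central n k k≤n) ⟩
      ⟦ (k C (n ∸ k)) ℕ.* central k ⟧    ≡⟨ ⟦⟧-homo-* (k C (n ∸ k)) (central k) ⟩
      ⟦ k C (n ∸ k) ⟧ * ⟦ central k ⟧    ∎

    summand-ι : ∀ {k} → k ≤ n → ⟦ 27 ^ n ⟧ * summand k ≡ ι (t k (n ∸ k))
    summand-ι {k} k≤n = begin
      ⟦ 27 ^ n ⟧ * (s * B₁ * B₂ * g₁ * g₂)
        ≡⟨ cong (_* (s * B₁ * B₂ * g₁ * g₂)) 27^n≡ ⟩
      ⟦ 27 ^ i ⟧ * ⟦ 27 ^ k ⟧ * (s * B₁ * B₂ * g₁ * g₂)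
        ≡⟨ regroup ⟦ 27 ^ i ⟧ ⟦ 27 ^ k ⟧ s B₁ B₂ g₁ g₂ ⟩
      s * ⟦ 27 ^ i ⟧ * (B₁ * B₂) * (⟦ 27 ^ k ⟧ * (g₁ * g₂))
        ≡⟨ cong₂ (λ x y → x * y * (⟦ 27 ^ k ⟧ * (g₁ * g₂))) sign≡ (binomℚ-revision k≤n) ⟩
      P * (⟦ k C i ⟧ * ⟦ central k ⟧) * (⟦ 27 ^ k ⟧ * (g₁ * g₂))
        ≡⟨ cong (λ x → P * (⟦ k C i ⟧ * ⟦ central k ⟧) * x) (gbinom-product k) ⟩
      P * (⟦ k C i ⟧ * ⟦ central k ⟧) * ι (a k)
        ≡⟨ reassociate P ⟦ k C i ⟧ ⟦ central k ⟧ (ι (a k)) ⟩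
      P * ⟦ k C i ⟧ * (⟦ central k ⟧ * ι (a k))
        ≡⟨ cong₂ _*_ (ι-homo-* ((ℤ.- + 27) ℤ.^ i) (+ (k C i))) (ι-homo-* (+ central k) (a k)) ⟨
      ι ((ℤ.- + 27) ℤ.^ i ℤ.* + (k C i)) * ι (b k)
        ≡⟨ ι-homo-* ((ℤ.- + 27) ℤ.^ i ℤ.* + (k C i)) (b k) ⟨
      ι (t k i) ∎
      where
      i = n ∸ k
      s = sign (n ℕ.+ k)
      B₁ = binomℚ n k
      B₂ = binomℚ (2 ℕ.* k) n
      g₁ = gbinom τ₁ k
      g₂ = gbinom τ₂ k
      P = ι ((ℤ.- + 27) ℤ.^ i)
      n≡i+k : n ≡ i ℕ.+ k
      n≡i+k = sym (ℕP.m∸n+n≡m k≤n)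
      27^n≡ : ⟦ 27 ^ n ⟧ ≡ ⟦ 27 ^ i ⟧ * ⟦ 27 ^ k ⟧
      27^n≡ = trans (cong (λ m → ⟦ 27 ^ m ⟧) n≡i+k)
                    (trans (cong ⟦_⟧ (ℕP.^-distribˡ-+-* 27 i k)) (⟦⟧-homo-* (27 ^ i) (27 ^ k)))
      sign≡ : s * ⟦ 27 ^ i ⟧ ≡ P
      sign≡ = trans (cong (λ m → sign m * ⟦ 27 ^ i ⟧) (trans (cong (ℕ._+ k) n≡i+k) (ℕP.+-assoc i k k)))
                    (trans (cong (_* ⟦ 27 ^ i ⟧) (sign-+-even i k)) (sign-*-27^ i))
      regroup : ∀ A B s B₁ B₂ g₁ g₂ → A * B * (s * B₁ * B₂ * g₁ * g₂) ≡ s * A * (B₁ * B₂) * (B * (g₁ * g₂))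
      regroup = solve 7 (λ A B s B₁ B₂ g₁ g₂ →
        A :* B :* (s :* B₁ :* B₂ :* g₁ :* g₂) := s :* A :* (B₁ :* B₂) :* (B :* (g₁ :* g₂))) refl
      reassociate : ∀ p x y z → p * (x * y) * z ≡ p * x * (y * z)
      reassociate = solve 4 (λ p x y z → p :* (x :* y) :* z := p :* x :* (y :* z)) refl

  lhs-sum : ∀ n → Σ≤ n (λ k → trinom k * trinom (n ∸ k)) ≡ ι (conv (λ k j → a k ℤ.* a j) n)
  lhs-sum n = trans (Σ≤-cong n (λ k _ → trans (cong₂ _*_ (trinom≡ι k) (trinom≡ι (n ∸ k)))
                                               (sym (ι-homo-* (a k) (a (n ∸ k))))))
                    (Σ≤-ι n (λ k → a k ℤ.* a (n ∸ k)))

  rhs-sum : ∀ n → ⟦ 27 ^ n ⟧ * Σ≤ n (summand n) ≡ ι (conv t n)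
  rhs-sum n = trans (*-distribˡ-Σ≤ n ⟦ 27 ^ n ⟧ (summand n))
                    (trans (Σ≤-cong n (λ k k≤n → summand-ι n k≤n)) (Σ≤-ι n (λ k → t k (n ∸ k))))

  mainTheorem19 : (n : ℕ) →
    binomℚ (2 Data.Nat.* n) n * Σ≤ n (λ k → trinom k * trinom (n ∸ k))
      ≡ ⟦ 27 ^ n ⟧ * binomℚ (2 Data.Nat.* n) n
          * Σ≤ n (λ k → sign (n Data.Nat.+ k) * binomℚ n k * binomℚ (2 Data.Nat.* k) n
                         * gbinom (-[1+ 0 ] / 3) k * gbinom (-[1+ 1 ] / 3) k)
  mainTheorem19 n = begin
    B * Σ≤ n (λ k → trinom k * trinom (n ∸ k))    ≡⟨ cong (B *_) (lhs-sum n) ⟩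
    B * ι (conv (λ k j → a k ℤ.* a j) n)          ≡⟨ cong (λ x → B * ι x) (convolution-identity n) ⟩
    B * ι (conv t n)                              ≡⟨ cong (B *_) (rhs-sum n) ⟨
    B * (⟦ 27 ^ n ⟧ * Σ≤ n (summand n))           ≡⟨ ℚP.*-assoc B ⟦ 27 ^ n ⟧ _ ⟨
    B * ⟦ 27 ^ n ⟧ * Σ≤ n (summand n)             ≡⟨ cong (_* Σ≤ n (summand n)) (ℚP.*-comm B ⟦ 27 ^ n ⟧) ⟩
    ⟦ 27 ^ n ⟧ * B * Σ≤ n (summand n)             ∎
    where
    B = binomℚ (2 Data.Nat.* n) n
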